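{- For all positive integers $k,n$ one has $\chi(\mathbb{R}^n_\infty;\mathcal B_k)\ge \left(\frac{k+1}{k}\right)^n$.
   Context: $\mathbb{R}^n_\infty$ denotes $\mathbb{R}^n$ with the maximum metric $\|\mathbf x-\mathbf y\|_\infty=\max_i|x_i-y_i|$. $\mathcal B_k$ is the metric space $\{0,1,\dots,k\}\subset\mathbb R$ with the metric induced from $\mathbb R$. A copy of a metric space $\mathcal Y$ in a metric space $\mathbb X$ is a subset of $\mathbb X$ isometric to $\mathcal Y$; $\chi(\mathbb X;\mathcal Y)$ is the minimal number of colors in a coloring of the points of $\mathbb X$ with no monochromatic copy of $\mathcal Y$. -}

module Defs where

open import Data.Nat as ℕ using (ℕ; zero; suc)
open import Data.Fin using (Fin; toℕ)
open import Data.Product using (Σ; ∃; _×_; _,_)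
open import Data.Sum using (_⊎_)
open import Relation.Binary.PropositionalEquality using (_≡_)
open import Relation.Nullary using (¬_)
open import Algebra.Structures using (IsCommutativeRing)

-- An axiomatisation of the real numbers: a Dedekind-complete ordered field
-- (unique up to isomorphism).  The statement is quantified over every such
-- structure.
record RealField : Set₁ where
  infixl 6 _+_ _-_
  infixl 7 _*_
  infix  4 _≤_
  field
    ℝ    : Set
    _+_  : ℝ → ℝ → ℝ
    _*_  : ℝ → ℝ → ℝ
    -_   : ℝ → ℝ
    0ℝ   : ℝ
    1ℝ   : ℝ
    _≤_  : ℝ → ℝ → Set
    isCommutativeRing : IsCommutativeRing _≡_ _+_ _*_ -_ 0ℝ 1ℝ
    0≢1     : ¬ (0ℝ ≡ 1ℝ)
    inverse : ∀ x → ¬ (x ≡ 0ℝ) → ∃ λ y → x * y ≡ 1ℝ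
    ≤-refl    : ∀ x → x ≤ x
    ≤-trans   : ∀ {x y z} → x ≤ y → y ≤ z → x ≤ z
    ≤-antisym : ∀ {x y} → x ≤ y → y ≤ x → x ≡ y
    ≤-total   : ∀ x y → x ≤ y ⊎ y ≤ x
    +-mono-≤  : ∀ {x y} z → x ≤ y → x + z ≤ y + z
    *-nonneg  : ∀ {x y} → 0ℝ ≤ x → 0ℝ ≤ y → 0ℝ ≤ x * y
    complete  : (P : ℝ → Set) → (∃ λ x → P x) →
                (∃ λ b → ∀ x → P x → x ≤ b) →
                ∃ λ s → (∀ x → P x → x ≤ s) ×
                        (∀ b → (∀ x → P x → x ≤ b) → s ≤ b)

  _-_ : ℝ → ℝ → ℝ
  x - y = x + (- y)

  fromℕ : ℕ → ℝ
  fromℕ zero    = 0ℝ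
  fromℕ (suc n) = 1ℝ + fromℕ n

  AbsDiff : ℝ → ℝ → ℝ → Set
  AbsDiff a b d = (a - b ≡ d ⊎ b - a ≡ d) × (0ℝ ≤ d)

  AbsDiff≤ : ℝ → ℝ → ℝ → Set
  AbsDiff≤ a b d = (a - b ≤ d) × (b - a ≤ d)

  -- ‖x - y‖∞ = d   in ℝⁿ (points as functions Fin n → ℝ), for n ≥ 1
  MaxDist : (n : ℕ) → (Fin n → ℝ) → (Fin n → ℝ) → ℝ → Set
  MaxDist n x y d = (∀ m → AbsDiff≤ (x m) (y m) d) × (∃ λ m → AbsDiff (x m) (y m) d)

  -- A copy of 𝓑ₖ = {0,…,k} in ℝⁿ_∞ : an isometric embedding f of {0,…,k}
  -- (its image is the copy; isometry forces injectivity).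
  IsCopyOfB : (n k : ℕ) → (Fin (suc k) → Fin n → ℝ) → Set
  IsCopyOfB n k f = ∀ i j → MaxDist n (f i) (f j) (fromℕ ℕ.∣ toℕ i - toℕ j ∣)

  HasMonoCopy : (n k c : ℕ) → ((Fin n → ℝ) → Fin c) → Set
  HasMonoCopy n k c col =
    ∃ λ (f : Fin (suc k) → Fin n → ℝ) → IsCopyOfB n k f × (∀ i j → col (f i) ≡ col (f j))

-- Every S ⊆ {0,…,k}ⁿ with more than kⁿ points contains a copy of 𝓑ₖ.  By induction on n:
-- slice the grid by the first coordinate t and call a point of S reached if it ends a
-- chain in S that starts on layer 0 and climbs one layer per step while moving at most 1
-- in the remaining coordinates.  A reached point on the top layer t = k gives a copy (its
-- chain, the first coordinate being the isometric one).  Otherwise moving every unreached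
-- point down one layer is injective on S and lands in k layers; one of them holds more than
-- kⁿ⁻¹ points, hence a copy in dimension n - 1, which lifts back to S.  With c colours and
-- c kⁿ < (k+1)ⁿ some colour class is that large, and the grid sits isometrically in ℝⁿ_∞.
module Submission where

open import Defs
open import Data.Nat using (ℕ; suc; _+_; _*_; _^_; _<_)
open import Data.Fin using (Fin)

open import Data.Fin.Base using (zero; suc; toℕ)
open import Data.Nat.Base using (zero)
open import Data.Product using (∃; _×_; _,_)
open import Data.Vec using (Vec; []; _∷_; lookup)
open import Function using (_∘_)
open import Relation.Binary.PropositionalEquality

module Lattice where

  open import Data.Bool.Base using (Bool; true; false)
  open import Data.Empty using (⊥; ⊥-elim)
  open import Data.Fin.Base using (inject₁; fromℕ)
  open import Data.Fin.Properties
    using (_≟_; toℕ<n; toℕ≤pred[n]; toℕ-injective; toℕ-inject₁; toℕ-fromℕ)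
  open import Data.Nat.Base using (_≤_; _∸_; _⊔_; ∣_-_∣; z≤n; s≤s)
  open import Data.Nat.Properties hiding (_≟_)
  open import Algebra.Properties.CommutativeMonoid.Sum +-0-commutativeMonoid
    using (sum-syntax; sum-cong-≗; ∑-distrib-+; ∑-comm; sum-init-last)
  open import Data.Sum using (_⊎_; inj₁; inj₂; [_,_]′)
  open import Data.Vec.Functional using () renaming (_∷_ to _◂_)
  open import Data.Vec.Relation.Unary.All using (All; []; _∷_)
  open import Relation.Nullary using (¬_; Dec; yes; no; does; map′; ¬?; _×-dec_; _⊎-dec_)
  open import Relation.Unary using (Decidable)

  dist : ∀ {m} → Vec ℕ m → Vec ℕ m → ℕ
  dist []      []      = 0
  dist (x ∷ a) (y ∷ b) = ∣ x - y ∣ ⊔ dist a b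

  dist-self : ∀ {m} (a : Vec ℕ m) → dist a a ≡ 0
  dist-self []      = refl
  dist-self (x ∷ a) = cong₂ _⊔_ (∣n-n∣≡0 x) (dist-self a)

  dist-comm : ∀ {m} (a b : Vec ℕ m) → dist a b ≡ dist b a
  dist-comm []      []      = refl
  dist-comm (x ∷ a) (y ∷ b) = cong₂ _⊔_ (∣-∣-comm x y) (dist-comm a b)

  dist-triangle : ∀ {m} (a b c : Vec ℕ m) → dist a c ≤ dist a b + dist b c
  dist-triangle []      []      []      = z≤n
  dist-triangle (x ∷ a) (y ∷ b) (z ∷ c) = ⊔-lub
    (≤-trans (∣-∣-triangle x y z)
             (+-mono-≤ (m≤m⊔n ∣ x - y ∣ (dist a b)) (m≤m⊔n ∣ y - z ∣ (dist b c))))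
    (≤-trans (dist-triangle a b c)
             (+-mono-≤ (m≤n⊔m ∣ x - y ∣ (dist a b)) (m≤n⊔m ∣ y - z ∣ (dist b c))))

  ∣lookup-lookup∣≤dist : ∀ {m} (a b : Vec ℕ m) p → ∣ lookup a p - lookup b p ∣ ≤ dist a b
  ∣lookup-lookup∣≤dist (x ∷ a) (y ∷ b) zero    = m≤m⊔n _ _
  ∣lookup-lookup∣≤dist (x ∷ a) (y ∷ b) (suc p) = ≤-trans (∣lookup-lookup∣≤dist a b p) (m≤n⊔m _ _)

  dist-attained : ∀ {m} (a b : Vec ℕ (suc m)) → ∃ λ p → ∣ lookup a p - lookup b p ∣ ≡ dist a b
  dist-attained (x ∷ [])    (y ∷ [])    = zero , sym (⊔-identityʳ _)
  dist-attained (x ∷ a@(_ ∷ _)) (y ∷ b@(_ ∷ _)) with ⊔-sel ∣ x - y ∣ (dist a b)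
  ... | inj₁ eq = zero , sym eq
  ... | inj₂ eq with dist-attained a b
  ...   | p , attained = suc p , trans attained (sym eq)

  IsCopy : ∀ {k m} → (Fin k → Vec ℕ m) → Set
  IsCopy f = ∀ i j → dist (f i) (f j) ≡ ∣ toℕ i - toℕ j ∣

  Lipschitz : ∀ {k m} → (Fin k → Vec ℕ m) → Set
  Lipschitz p = ∀ i j → dist (p i) (p j) ≤ ∣ toℕ i - toℕ j ∣

  lipschitz-◂ : ∀ {k m} {a : Vec ℕ m} {p : Fin (suc k) → Vec ℕ m} →
                dist a (p zero) ≤ 1 → Lipschitz p → Lipschitz (a ◂ p)
  lipschitz-◂ {a = a} _ _ zero zero = ≤-reflexive (dist-self a)
  lipschitz-◂ {a = a} {p} a~p₀ p-lip zero (suc j) =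
    ≤-trans (dist-triangle a (p zero) (p j)) (+-mono-≤ a~p₀ (p-lip zero j))
  lipschitz-◂ {a = a} {p} a~p₀ p-lip (suc i) zero =
    subst (_≤ suc (toℕ i)) (dist-comm a (p i)) (lipschitz-◂ {a = a} {p} a~p₀ p-lip zero (suc i))
  lipschitz-◂ _ p-lip (suc i) (suc j) = p-lip i j

  isometric-∷-lipschitz⇒isCopy : ∀ {k m} {x : Fin k → ℕ} {p : Fin k → Vec ℕ m} →
    (∀ i j → ∣ x i - x j ∣ ≡ ∣ toℕ i - toℕ j ∣) → Lipschitz p → IsCopy (λ i → x i ∷ p i)
  isometric-∷-lipschitz⇒isCopy x-iso p-lip i j =
    trans (cong (_⊔ _) (x-iso i j)) (m≥n⇒m⊔n≡m (p-lip i j))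

  lipschitz-∷-isCopy⇒isCopy : ∀ {k m} {x : Fin k → ℕ} {p : Fin k → Vec ℕ m} →
    (∀ i j → ∣ x i - x j ∣ ≤ ∣ toℕ i - toℕ j ∣) → IsCopy p → IsCopy (λ i → x i ∷ p i)
  lipschitz-∷-isCopy⇒isCopy x-lip p-copy i j =
    trans (cong (_ ⊔_) (p-copy i j)) (m≤n⇒m⊔n≡n (x-lip i j))

  ∣-∣≤1⇒lipschitz : ∀ {k} (x : Fin k → ℕ) → (∀ i j → ∣ x i - x j ∣ ≤ 1) →
                    ∀ i j → ∣ x i - x j ∣ ≤ ∣ toℕ i - toℕ j ∣
  ∣-∣≤1⇒lipschitz x close i j with i ≟ j
  ... | yes refl = ≤-reflexive (trans (∣n-n∣≡0 (x i)) (sym (∣n-n∣≡0 (toℕ i))))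
  ... | no i≢j   = ≤-trans (close i j) (n≢0⇒n>0 (i≢j ∘ toℕ-injective ∘ ∣m-n∣≡0⇒m≡n))

  ∣k∸m-k∸n∣≡∣m-n∣ : ∀ {k m n} → m ≤ k → n ≤ k → ∣ k ∸ m - k ∸ n ∣ ≡ ∣ m - n ∣
  ∣k∸m-k∸n∣≡∣m-n∣ z≤n       n≤k       = ∣k-k∸n∣≡n n≤k
    where
    ∣k-k∸n∣≡n : ∀ {k n} → n ≤ k → ∣ k - k ∸ n ∣ ≡ n
    ∣k-k∸n∣≡n {k} {n} n≤k = trans (m≤n⇒∣n-m∣≡n∸m (m∸n≤m k n)) (m∸[m∸n]≡n n≤k)
  ∣k∸m-k∸n∣≡∣m-n∣ {suc k} {suc m} (s≤s m≤k) z≤n =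
    trans (∣-∣-comm (k ∸ m) (suc k)) (∣k∸m-k∸n∣≡∣m-n∣ {suc k} z≤n (s≤s m≤k))
  ∣k∸m-k∸n∣≡∣m-n∣ (s≤s m≤k) (s≤s n≤k) = ∣k∸m-k∸n∣≡∣m-n∣ m≤k n≤k

  𝟙 : Bool → ℕ
  𝟙 true  = 1
  𝟙 false = 0

  𝟙≤1 : ∀ b → 𝟙 b ≤ 1
  𝟙≤1 true  = ≤-refl
  𝟙≤1 false = z≤n

  𝟙-∅ : ∀ {A : Set} (A? : Dec A) → ¬ A → 𝟙 (does A?) ≡ 0
  𝟙-∅ (yes a) ¬a = ⊥-elim (¬a a)
  𝟙-∅ (no _)  _  = refl

  𝟙-∖ : ∀ {A B : Set} (A? : Dec A) (B? : Dec B) → (B → A) →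
        𝟙 (does A?) ≡ 𝟙 (does (A? ×-dec ¬? B?)) + 𝟙 (does B?)
  𝟙-∖ (yes _) (yes _) _   = refl
  𝟙-∖ (yes _) (no _)  _   = refl
  𝟙-∖ (no _)  (no _)  _   = refl
  𝟙-∖ (no ¬a) (yes b) B⇒A = ⊥-elim (¬a (B⇒A b))

  𝟙-⊎ : ∀ {A B : Set} (A? : Dec A) (B? : Dec B) → (A → B → ⊥) →
        𝟙 (does (A? ⊎-dec B?)) ≡ 𝟙 (does A?) + 𝟙 (does B?)
  𝟙-⊎ (yes a) (yes b) disjoint = ⊥-elim (disjoint a b)
  𝟙-⊎ (yes _) (no _)  _        = refl
  𝟙-⊎ (no _)  (yes _) _        = refl
  𝟙-⊎ (no _)  (no _)  _        = refl

  ∑-const : ∀ n x → ∑[ i < n ] x ≡ n * x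
  ∑-const zero    x = refl
  ∑-const (suc n) x = cong (x +_) (∑-const n x)

  ∑-𝟙-≟ : ∀ {c} (x : Fin c) → ∑[ d < c ] 𝟙 (does (x ≟ d)) ≡ 1
  ∑-𝟙-≟ {suc c} zero = cong suc (trans (∑-const c 0) (*-zeroʳ c))
  ∑-𝟙-≟ (suc x) = ∑-𝟙-≟ x

  ∑-pigeonhole : ∀ n (f : Fin n → ℕ) B → n * B < ∑[ i < n ] f i → ∃ λ i → B < f i
  ∑-pigeonhole (suc n) f B big with B <? f zero
  ... | yes B<f₀ = zero , B<f₀
  ... | no  B≮f₀ with ∑-pigeonhole n (f ∘ suc) B
                        (+-cancelˡ-< B _ _ (<-≤-trans big (+-monoˡ-≤ _ (≮⇒≥ B≮f₀))))
  ...   | i , B<fᵢ = suc i , B<fᵢ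

  module Grid (K : ℕ) where

    -- Subsets of the grid {0,…,K}ᵐ are decidable predicates on ℕᵐ; points outside the
    -- grid are never counted or searched.
    InGrid : ∀ {m} → Vec ℕ m → Set
    InGrid = All (_< suc K)

    ∑ᵍ : ∀ m → (Vec ℕ m → ℕ) → ℕ
    ∑ᵍ zero    g = g []
    ∑ᵍ (suc m) g = ∑[ t < suc K ] ∑ᵍ m (λ a → g (toℕ t ∷ a))

    ∑ᵍ-cong : ∀ m {g h : Vec ℕ m → ℕ} → (∀ a → InGrid a → g a ≡ h a) → ∑ᵍ m g ≡ ∑ᵍ m h
    ∑ᵍ-cong zero    g≗h = g≗h [] []
    ∑ᵍ-cong (suc m) g≗h = sum-cong-≗ {suc K} λ t → ∑ᵍ-cong m λ a a∈ → g≗h _ (toℕ<n t ∷ a∈)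

    ∑ᵍ-distrib-+ : ∀ m (g h : Vec ℕ m → ℕ) → ∑ᵍ m (λ a → g a + h a) ≡ ∑ᵍ m g + ∑ᵍ m h
    ∑ᵍ-distrib-+ zero    g h = refl
    ∑ᵍ-distrib-+ (suc m) g h =
      trans (sum-cong-≗ {suc K} λ t → ∑ᵍ-distrib-+ m (g ∘ (toℕ t ∷_)) (h ∘ (toℕ t ∷_)))
            (∑-distrib-+ {suc K} (λ t → ∑ᵍ m (g ∘ (toℕ t ∷_))) (λ t → ∑ᵍ m (h ∘ (toℕ t ∷_))))

    ∑ᵍ-comm : ∀ m {c} (h : Vec ℕ m → Fin c → ℕ) →
              ∑ᵍ m (λ a → ∑[ d < c ] h a d) ≡ ∑[ d < c ] ∑ᵍ m (λ a → h a d)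
    ∑ᵍ-comm zero    h = refl
    ∑ᵍ-comm (suc m) {c} h =
      trans (sum-cong-≗ {suc K} λ t → ∑ᵍ-comm m (h ∘ (toℕ t ∷_)))
            (∑-comm {suc K} {c} λ t d → ∑ᵍ m (λ a → h (toℕ t ∷ a) d))

    ∑ᵍ-const : ∀ m x → ∑ᵍ m (λ _ → x) ≡ suc K ^ m * x
    ∑ᵍ-const zero    x = sym (*-identityˡ x)
    ∑ᵍ-const (suc m) x = begin
      ∑[ t < suc K ] ∑ᵍ m (λ _ → x)  ≡⟨ sum-cong-≗ {suc K} (λ _ → ∑ᵍ-const m x) ⟩
      ∑[ t < suc K ] (suc K ^ m * x) ≡⟨ ∑-const (suc K) _ ⟩
      suc K * (suc K ^ m * x)        ≡⟨ *-assoc (suc K) (suc K ^ m) x ⟨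
      suc K ^ suc m * x              ∎
      where open ≡-Reasoning

    ∃ᵍ? : ∀ m {P : Vec ℕ m → Set} → Decidable P → Dec (∃ λ a → InGrid a × P a)
    ∃ᵍ? zero    P? = map′ (λ pa → [] , [] , pa) (λ { ([] , [] , pa) → pa }) (P? [])
    ∃ᵍ? (suc m) P? = map′
      (λ { (t , t< , a , a∈ , pa) → t ∷ a , t< ∷ a∈ , pa })
      (λ { (t ∷ a , t< ∷ a∈ , pa) → t , t< , a , a∈ , pa })
      (anyUpTo? (λ t → ∃ᵍ? m (P? ∘ (t ∷_))) (suc K))

    card : ∀ m {P : Vec ℕ m → Set} → Decidable P → ℕ
    card m P? = ∑ᵍ m (λ a → 𝟙 (does (P? a)))

    card-∅ : ∀ m {P : Vec ℕ m → Set} (P? : Decidable P) →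
             (∀ a → InGrid a → ¬ P a) → card m P? ≡ 0
    card-∅ m P? empty = begin
      card m P?              ≡⟨ ∑ᵍ-cong m (λ a a∈ → 𝟙-∅ (P? a) (empty a a∈)) ⟩
      ∑ᵍ m (λ _ → 0)         ≡⟨ ∑ᵍ-const m 0 ⟩
      suc K ^ m * 0          ≡⟨ *-zeroʳ (suc K ^ m) ⟩
      0                      ∎
      where open ≡-Reasoning

    card-∖ : ∀ m {P Q : Vec ℕ m → Set} (P? : Decidable P) (Q? : Decidable Q) →
             (∀ a → Q a → P a) → card m P? ≡ card m (λ a → P? a ×-dec ¬? (Q? a)) + card m Q?
    card-∖ m P? Q? Q⊆P =
      trans (∑ᵍ-cong m λ a _ → 𝟙-∖ (P? a) (Q? a) (Q⊆P a)) (∑ᵍ-distrib-+ m _ _)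

    card-⊎ : ∀ m {P Q : Vec ℕ m → Set} (P? : Decidable P) (Q? : Decidable Q) →
             (∀ a → InGrid a → P a → Q a → ⊥) →
             card m (λ a → P? a ⊎-dec Q? a) ≡ card m P? + card m Q?
    card-⊎ m P? Q? disjoint =
      trans (∑ᵍ-cong m λ a a∈ → 𝟙-⊎ (P? a) (Q? a) (disjoint a a∈)) (∑ᵍ-distrib-+ m _ _)

    Copy : ∀ m → (Vec ℕ m → Set) → Set
    Copy m P = ∃ λ (f : Fin (suc K) → Vec ℕ m) → IsCopy f × ∀ i → P (f i)

    module Layers (m : ℕ) {S : Vec ℕ (suc m) → Set} (S? : Decidable S) where

      Reach : ℕ → Vec ℕ m → Set
      Reach zero    a = S (0 ∷ a)
      Reach (suc t) a = S (suc t ∷ a) × ∃ λ b → InGrid b × Reach t b × dist a b ≤ 1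

      Reach? : ∀ t → Decidable (Reach t)
      Reach? zero    a = S? (0 ∷ a)
      Reach? (suc t) a = S? (suc t ∷ a) ×-dec ∃ᵍ? m (λ b → Reach? t b ×-dec dist a b ≤? 1)

      Reach⇒S : ∀ t {a} → Reach t a → S (t ∷ a)
      Reach⇒S zero    s       = s
      Reach⇒S (suc t) (s , _) = s

      descent : ∀ t a → Reach t a → ∃ λ (p : Fin (suc t) → Vec ℕ m) →
                p zero ≡ a × Lipschitz p × ∀ i → Reach (t ∸ toℕ i) (p i)
      descent zero    a r =
        (λ _ → a) , refl , (λ { zero zero → ≤-reflexive (dist-self a) }) , λ { zero → r }
      descent (suc t) a r@(_ , b , _ , rb , a~b) with descent t b rb
      ... | p , refl , p-lip , p-reach =
        a ◂ p , refl , lipschitz-◂ a~b p-lip , λ { zero → r ; (suc i) → p-reach i }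

      reach-top⇒copy : ∀ {a} → Reach K a → Copy (suc m) S
      reach-top⇒copy {a} r with descent K a r
      ... | p , _ , p-lip , p-reach =
        (λ i → K ∸ toℕ i ∷ p i) ,
        isometric-∷-lipschitz⇒isCopy {x = λ i → K ∸ toℕ i} {p}
          (λ i j → ∣k∸m-k∸n∣≡∣m-n∣ (toℕ≤pred[n] i) (toℕ≤pred[n] j)) p-lip ,
        λ i → Reach⇒S _ (p-reach i)

      Unreached : ℕ → Vec ℕ m → Set
      Unreached t a = S (t ∷ a) × ¬ Reach t a

      Unreached? : ∀ t → Decidable (Unreached t)
      Unreached? t a = S? (t ∷ a) ×-dec ¬? (Reach? t a)

      Lowered : ℕ → Vec ℕ m → Set
      Lowered t a = Unreached (suc t) a ⊎ Reach t a

      Lowered? : ∀ t → Decidable (Lowered t)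
      Lowered? t a = Unreached? (suc t) a ⊎-dec Reach? t a

      unreached-reach-disjoint : ∀ t a → InGrid a → Unreached (suc t) a → Reach t a → ⊥
      unreached-reach-disjoint t a a∈ (s , ¬r) r =
        ¬r (s , a , a∈ , r , subst (_≤ 1) (sym (dist-self a)) z≤n)

      lift : ℕ → Vec ℕ m → Vec ℕ (suc m)
      lift t a = 𝟙 (does (Unreached? (suc t) a)) + t ∷ a

      lift-∈ : ∀ t {a} → Lowered t a → S (lift t a)
      lift-∈ t {a} = by-cases (Unreached? (suc t) a)
        where
        by-cases : (u? : Dec (Unreached (suc t) a)) → Lowered t a → S (𝟙 (does u?) + t ∷ a)
        by-cases (yes (s , _)) _ = s
        by-cases (no ¬u)       l = [ ⊥-elim ∘ ¬u , Reach⇒S t ]′ l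

      lowered-copy⇒copy : ∀ t → Copy m (Lowered t) → Copy (suc m) S
      lowered-copy⇒copy t (f , f-copy , f∈) =
        lift t ∘ f ,
        lipschitz-∷-isCopy⇒isCopy {x = height} {f} (∣-∣≤1⇒lipschitz height height-close) f-copy ,
        lift-∈ t ∘ f∈
        where
        height : Fin (suc K) → ℕ
        height i = 𝟙 (does (Unreached? (suc t) (f i))) + t
        height-close : ∀ i j → ∣ height i - height j ∣ ≤ 1
        height-close i j = begin
          ∣ u + t - v + t ∣ ≡⟨ cong₂ ∣_-_∣ (+-comm u t) (+-comm v t) ⟩
          ∣ t + u - t + v ∣ ≡⟨ ∣m+n-m+o∣≡∣n-o∣ t u v ⟩
          ∣ u - v ∣         ≤⟨ ∣m-n∣≤m⊔n u v ⟩
          u ⊔ v             ≤⟨ ⊔-lub (𝟙≤1 (does uᵢ?)) (𝟙≤1 (does uⱼ?)) ⟩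
          1                 ∎
          where
          open ≤-Reasoning
          uᵢ? = Unreached? (suc t) (f i)
          uⱼ? = Unreached? (suc t) (f j)
          u = 𝟙 (does uᵢ?)
          v = 𝟙 (does uⱼ?)

      card-lowering : (∀ a → InGrid a → ¬ Reach K a) →
                      card (suc m) S? ≡ ∑[ t < K ] card m (Lowered? (toℕ t))
      card-lowering top-unreached = begin
        card (suc m) S?
          ≡⟨ sum-cong-≗ {suc K} (λ t → card-∖ m (S? ∘ (toℕ t ∷_)) (Reach? (toℕ t))
                                                (λ _ → Reach⇒S (toℕ t))) ⟩
        ∑[ t < suc K ] (u (toℕ t) + r (toℕ t))
          ≡⟨ ∑-distrib-+ {suc K} (u ∘ toℕ) (r ∘ toℕ) ⟩
        u 0 + ∑[ t < K ] u (suc (toℕ t)) + ∑[ t < suc K ] r (toℕ t)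
          ≡⟨ cong₂ _+_ (cong (_+ ∑u) u₀≡0) (sum-init-last {K} (r ∘ toℕ)) ⟩
        ∑[ t < K ] u (suc (toℕ t)) + (∑[ t < K ] r (toℕ (inject₁ t)) + r (toℕ (fromℕ K)))
          ≡⟨ cong (∑u +_) (cong₂ _+_ (sum-cong-≗ {K} (cong r ∘ toℕ-inject₁)) rₖ≡0) ⟩
        ∑[ t < K ] u (suc (toℕ t)) + (∑[ t < K ] r (toℕ t) + 0)
          ≡⟨ cong (∑u +_) (+-identityʳ _) ⟩
        ∑[ t < K ] u (suc (toℕ t)) + ∑[ t < K ] r (toℕ t)
          ≡⟨ ∑-distrib-+ {K} (u ∘ suc ∘ toℕ) (r ∘ toℕ) ⟨
        ∑[ t < K ] (u (suc (toℕ t)) + r (toℕ t))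
          ≡⟨ sum-cong-≗ {K} (λ t → card-⊎ m (Unreached? (suc (toℕ t))) (Reach? (toℕ t))
                                            (unreached-reach-disjoint (toℕ t))) ⟨
        ∑[ t < K ] card m (Lowered? (toℕ t)) ∎
        where
        open ≡-Reasoning
        u r : ℕ → ℕ
        u t = card m (Unreached? t)
        r t = card m (Reach? t)
        ∑u = ∑[ t < K ] u (suc (toℕ t))
        u₀≡0 : u 0 ≡ 0
        u₀≡0 = card-∅ m (Unreached? 0) (λ _ _ (s , ¬s) → ¬s s)
        rₖ≡0 : r (toℕ (fromℕ K)) ≡ 0
        rₖ≡0 = trans (cong r (toℕ-fromℕ K)) (card-∅ m (Reach? K) top-unreached)

      dense⇒copy-step : (∀ {P} (P? : Decidable P) → K ^ m < card m P? → Copy m P) →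
                        K ^ suc m < card (suc m) S? → Copy (suc m) S
      dense⇒copy-step dense⇒copyₘ dense with ∃ᵍ? m (Reach? K)
      ... | yes (a , _ , r) = reach-top⇒copy r
      ... | no ∄r
        with ∑-pigeonhole K _ (K ^ m)
               (subst (K ^ suc m <_) (card-lowering λ a a∈ r → ∄r (a , a∈ , r)) dense)
      ...   | t , t-dense = lowered-copy⇒copy (toℕ t) (dense⇒copyₘ (Lowered? (toℕ t)) t-dense)

    dense⇒copy : ∀ m {P : Vec ℕ m → Set} (P? : Decidable P) → K ^ m < card m P? → Copy m P
    dense⇒copy zero    P? dense = ⊥-elim (<⇒≱ dense (𝟙≤1 (does (P? []))))
    dense⇒copy (suc m) P?       = Layers.dense⇒copy-step m P? (dense⇒copy m)

    ∑-card-classes : ∀ m {c} (col : Vec ℕ m → Fin c) →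
                     ∑[ d < c ] card m (λ a → col a ≟ d) ≡ suc K ^ m
    ∑-card-classes m {c} col = begin
      ∑[ d < c ] ∑ᵍ m (λ a → 𝟙 (does (col a ≟ d))) ≡⟨ ∑ᵍ-comm m (λ a d → 𝟙 (does (col a ≟ d))) ⟨
      ∑ᵍ m (λ a → ∑[ d < c ] 𝟙 (does (col a ≟ d))) ≡⟨ ∑ᵍ-cong m (λ a _ → ∑-𝟙-≟ (col a)) ⟩
      ∑ᵍ m (λ _ → 1)                               ≡⟨ ∑ᵍ-const m 1 ⟩
      suc K ^ m * 1                                ≡⟨ *-identityʳ _ ⟩
      suc K ^ m                                    ∎
      where open ≡-Reasoning

    monochromatic-copy : ∀ m {c} (col : Vec ℕ m → Fin c) → c * K ^ m < suc K ^ m →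
                         ∃ λ d → Copy m (λ a → col a ≡ d)
    monochromatic-copy m {c} col few
      with ∑-pigeonhole c _ (K ^ m) (subst (c * K ^ m <_) (sym (∑-card-classes m col)) few)
    ... | d , d-dense = d , dense⇒copy m (λ a → col a ≟ d) d-dense

module Embedding (ℛ : RealField) where

  open RealField ℛ renaming (_+_ to _+ℝ_; _*_ to _*ℝ_)
  open import Algebra.Bundles using (CommutativeRing)
  import Algebra.Properties.Ring as RingProperties
  import Data.Nat.Base as ℕ
  import Data.Nat.Properties as ℕ
  open import Data.Sum using (inj₁; inj₂)
  open Lattice using (dist; dist-comm; IsCopy; ∣lookup-lookup∣≤dist; dist-attained; module Grid)

  commutativeRing : CommutativeRing _ _
  commutativeRing = record { isCommutativeRing = isCommutativeRing }

  open CommutativeRing commutativeRing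
    using (ring; +-abelianGroup; +-comm; +-assoc; +-identityˡ; -‿inverseʳ)
  open RingProperties ring using (-1*x≈-x; -‿involutive)
  open import Algebra.Properties.AbelianGroup +-abelianGroup using (xyx⁻¹≈y)

  x≤x+y : ∀ x {y} → 0ℝ ≤ y → x ≤ x +ℝ y
  x≤x+y x {y} 0≤y = subst₂ _≤_ (+-identityˡ x) (+-comm y x) (+-mono-≤ x 0≤y)

  0≤1 : 0ℝ ≤ 1ℝ
  0≤1 with ≤-total 0ℝ 1ℝ
  ... | inj₁ 0≤1 = 0≤1
  ... | inj₂ 1≤0 = subst (0ℝ ≤_) (trans (-1*x≈-x (- 1ℝ)) (-‿involutive 1ℝ)) (*-nonneg 0≤-1 0≤-1)
    where
    0≤-1 : 0ℝ ≤ - 1ℝ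
    0≤-1 = subst₂ _≤_ (-‿inverseʳ 1ℝ) (+-identityˡ (- 1ℝ)) (+-mono-≤ (- 1ℝ) 1≤0)

  0≤fromℕ : ∀ n → 0ℝ ≤ fromℕ n
  0≤fromℕ zero    = ≤-refl 0ℝ
  0≤fromℕ (suc n) = ≤-trans 0≤1 (x≤x+y 1ℝ (0≤fromℕ n))

  fromℕ-+ : ∀ m n → fromℕ (m + n) ≡ fromℕ m +ℝ fromℕ n
  fromℕ-+ zero    n = sym (+-identityˡ (fromℕ n))
  fromℕ-+ (suc m) n = trans (cong (1ℝ +ℝ_) (fromℕ-+ m n)) (sym (+-assoc 1ℝ (fromℕ m) (fromℕ n)))

  fromℕ-mono-≤ : ∀ {m n} → m ℕ.≤ n → fromℕ m ≤ fromℕ n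
  fromℕ-mono-≤ {m} {n} m≤n =
    subst (fromℕ m ≤_) (trans (sym (fromℕ-+ m (n ℕ.∸ m))) (cong fromℕ (ℕ.m+[n∸m]≡n m≤n)))
          (x≤x+y (fromℕ m) (0≤fromℕ (n ℕ.∸ m)))

  fromℕ-∸ : ∀ {m n} → n ℕ.≤ m → fromℕ m - fromℕ n ≡ fromℕ (m ℕ.∸ n)
  fromℕ-∸ {m} {n} n≤m = begin
    fromℕ m - fromℕ n                      ≡⟨ cong (λ k → fromℕ k - fromℕ n) (ℕ.m+[n∸m]≡n n≤m) ⟨
    fromℕ (n + (m ℕ.∸ n)) - fromℕ n        ≡⟨ cong (_- fromℕ n) (fromℕ-+ n (m ℕ.∸ n)) ⟩
    fromℕ n +ℝ fromℕ (m ℕ.∸ n) - fromℕ n   ≡⟨ xyx⁻¹≈y (fromℕ n) (fromℕ (m ℕ.∸ n)) ⟩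
    fromℕ (m ℕ.∸ n)                        ∎
    where open ≡-Reasoning

  fromℕ-∣-∣ : ∀ {m n} → n ℕ.≤ m → fromℕ m - fromℕ n ≡ fromℕ ℕ.∣ m - n ∣
  fromℕ-∣-∣ n≤m = trans (fromℕ-∸ n≤m) (cong fromℕ (sym (ℕ.m≤n⇒∣n-m∣≡n∸m n≤m)))

  fromℕ-diff≤ : ∀ m n → fromℕ m - fromℕ n ≤ fromℕ ℕ.∣ m - n ∣
  fromℕ-diff≤ m n with ℕ.≤-total n m
  ... | inj₁ n≤m = subst (fromℕ m - fromℕ n ≤_) (fromℕ-∣-∣ n≤m) (≤-refl _)
  ... | inj₂ m≤n = ≤-trans (subst (fromℕ m - fromℕ n ≤_) (-‿inverseʳ (fromℕ n))
                                  (+-mono-≤ (- fromℕ n) (fromℕ-mono-≤ m≤n)))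
                           (0≤fromℕ ℕ.∣ m - n ∣)

  fromℕ-absDiff : ∀ m n → AbsDiff (fromℕ m) (fromℕ n) (fromℕ ℕ.∣ m - n ∣)
  fromℕ-absDiff m n with ℕ.≤-total n m
  ... | inj₁ n≤m = inj₁ (fromℕ-∣-∣ n≤m) , 0≤fromℕ ℕ.∣ m - n ∣
  ... | inj₂ m≤n = inj₂ (trans (fromℕ-∣-∣ m≤n) (cong fromℕ (ℕ.∣-∣-comm n m))) , 0≤fromℕ ℕ.∣ m - n ∣

  embed : ∀ {n} → Vec ℕ n → Fin n → ℝ
  embed a p = fromℕ (lookup a p)

  embed-maxDist : ∀ {n} (a b : Vec ℕ (suc n)) →
                  MaxDist (suc n) (embed a) (embed b) (fromℕ (dist a b))
  embed-maxDist a b =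
    (λ p → bound a b p ,
           subst (λ d → embed b p - embed a p ≤ fromℕ d) (dist-comm b a) (bound b a p)) ,
    attained (dist-attained a b)
    where
    bound : ∀ a b p → embed a p - embed b p ≤ fromℕ (dist a b)
    bound a b p = ≤-trans (fromℕ-diff≤ (lookup a p) (lookup b p))
                          (fromℕ-mono-≤ (∣lookup-lookup∣≤dist a b p))
    attained : (∃ λ p → ℕ.∣ lookup a p - lookup b p ∣ ≡ dist a b) →
               ∃ λ p → AbsDiff (embed a p) (embed b p) (fromℕ (dist a b))
    attained (p , eq) =
      p , subst (AbsDiff (embed a p) (embed b p) ∘ fromℕ) eq (fromℕ-absDiff (lookup a p) (lookup b p))

  embed-isCopyOfB : ∀ {n k} {f : Fin (suc k) → Vec ℕ (suc n)} → IsCopy f →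
                    IsCopyOfB (suc n) k (embed ∘ f)
  embed-isCopyOfB {f = f} f-copy i j =
    subst (MaxDist _ (embed (f i)) (embed (f j)) ∘ fromℕ) (f-copy i j) (embed-maxDist (f i) (f j))

  gridCopy⇒HasMonoCopy : ∀ {n k c} (col : (Fin (suc n) → ℝ) → Fin c) →
    (∃ λ d → Grid.Copy k (suc n) (λ a → col (embed a) ≡ d)) → HasMonoCopy (suc n) k c col
  gridCopy⇒HasMonoCopy col (d , f , f-copy , f∈d) =
    embed ∘ f , embed-isCopyOfB {f = f} f-copy , λ i j → trans (f∈d i) (sym (f∈d j))

corollary1 : (R : RealField) → (k n c : ℕ) →
    c * (suc k) ^ (suc n) < (suc k + 1) ^ (suc n) →
    (col : (Fin (suc n) → RealField.ℝ R) → Fin c) →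
    RealField.HasMonoCopy R (suc n) (suc k) c col
corollary1 R k n c few col =
  gridCopy⇒HasMonoCopy col (Lattice.Grid.monochromatic-copy (suc k) (suc n) (col ∘ embed) few′)
  where
  open Embedding R
  open import Data.Nat.Properties using (+-comm)
  few′ : c * suc k ^ suc n < suc (suc k) ^ suc n
  few′ = subst (λ x → c * suc k ^ suc n < x ^ suc n) (+-comm (suc k) 1) few
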